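{- Let $X$ be a non-empty set equipped with the discrete topology, and give $X^\omega$ the product topology. If $S \subseteq X^\omega$ is of second category, then for each infinite $J\subseteq \omega$ and each function $f:J\rightarrow\bigcup_{n\in\omega}X^n$ there exists a sequence $\{a_n\}_{n\in\omega}$ belonging to $S$ such that for infinitely many $i\in J$ the infinite sequence $\{a_{i+n}\}_{n\in\omega}$ extends the finite sequence $f(i)$.
   Context: $\omega$ denotes the set of natural numbers $\{0,1,2,\dots\}$, and $X^n$ is the set of finite sequences of length $n$ of elements of $X$. An infinite sequence $\{b_n\}_{n\in\omega}$ extends a finite sequence $(c_0,\dots,c_{m-1})\in X^m$ if $b_j=c_j$ for all $j<m$. A set is of second category if it is not of first category (not a countable union of nowhere dense sets). -}

module Defs where

open import Data.Nat using (ℕ; _<_; _≤_)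
open import Data.Fin using (Fin; toℕ)
open import Data.Vec using (Vec; lookup)
open import Data.Product using (Σ; ∃; _×_)
open import Relation.Binary.PropositionalEquality using (_≡_)
open import Relation.Nullary using (¬_)
open import Function.Bundles using (_⇔_)

Seq : Set → Set
Seq X = ℕ → X

FinSeq : Set → Set
FinSeq X = Σ ℕ (Vec X)

Extends : {X : Set} → Seq X → FinSeq X → Set
Extends b (n Data.Product., c) = (j : Fin n) → b (toℕ j) ≡ lookup c j

-- a and b agree on the first n coordinates (b lies in the basic
-- open cylinder determined by a↾n)
Agree : {X : Set} → ℕ → Seq X → Seq X → Set
Agree n a b = ∀ j → j < n → a j ≡ b j

-- closure and interior in the product of discrete topologies
-- (the cylinders form a neighbourhood base at each point)
Closure : {X : Set} → (Seq X → Set) → Seq X → Set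
Closure A a = ∀ n → ∃ λ b → Agree n a b × A b

Interior : {X : Set} → (Seq X → Set) → Seq X → Set
Interior A a = ∃ λ n → ∀ b → Agree n a b → A b

NowhereDense : {X : Set} → (Seq X → Set) → Set
NowhereDense A = ∀ a → ¬ Interior (Closure A) a

FirstCategory : {X : Set} → (Seq X → Set) → Set₁
FirstCategory {X} S =
  Σ (ℕ → Seq X → Set) λ N →
    ((k : ℕ) → NowhereDense (N k)) × ((a : Seq X) → S a ⇔ (∃ λ k → N k a))

SecondCategory : {X : Set} → (Seq X → Set) → Set₁
SecondCategory S = ¬ FirstCategory S

Infinite : (ℕ → Set) → Set
Infinite J = ∀ n → ∃ λ m → n ≤ m × J m

{-# OPTIONS --safe #-}
module Submission where

open import Defs
open import Level using (0ℓ)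
open import Axiom.ExcludedMiddle using (ExcludedMiddle)
open import Axiom.DoubleNegationElimination using (DoubleNegationElimination; em⇒dne)
open import Data.Nat using (ℕ; zero; suc; _+_; _≤_; _⊔_; z<s; s<s)
open import Data.Nat.Properties using (+-monoʳ-<; <-≤-trans; ≤-trans; m≤m⊔n; m≤n⊔m)
open import Data.Fin using (Fin; toℕ)
open import Data.Fin.Properties using (toℕ<n)
open import Data.Vec using (Vec; []; _∷_)
open import Data.Product using (Σ; ∃; _×_; _,_; proj₁)
open import Relation.Nullary using (¬_)
open import Relation.Unary using (Pred; _⊆_; _∩_; ⋃)
open import Relation.Binary.PropositionalEquality using (refl; sym; trans)
open import Function.Bundles using (mk⇔)

-- For each n, the sequences a with no i ≥ n in J at which a shifted by i
-- extends f(i) form a nowhere dense set: any cylinder fixing the first m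
-- coordinates contains the smaller cylinder in which f(i) is written at
-- some i ≥ max(n, m) of J.  If no point of S had infinitely many such
-- hits, S would lie in the union of these sets and be of first category.

private
  variable
    X : Set

Closure-mono : {A B : Pred (Seq X) 0ℓ} → A ⊆ B → Closure A ⊆ Closure B
Closure-mono A⊆B cl n = let (b , a≈b , Ab) = cl n in b , a≈b , A⊆B Ab

Interior-mono : {A B : Pred (Seq X) 0ℓ} → A ⊆ B → Interior A ⊆ Interior B
Interior-mono A⊆B (n , int) = n , λ b a≈b → A⊆B (int b a≈b)

NowhereDense-⊆ : {A B : Pred (Seq X) 0ℓ} → A ⊆ B → NowhereDense B → NowhereDense A
NowhereDense-⊆ A⊆B ndB a int = ndB a (Interior-mono (Closure-mono A⊆B) int)

disjointSubcylinder⇒NowhereDense : {A : Pred (Seq X) 0ℓ} →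
  (∀ a n → ∃ λ b → Agree n a b × ∃ λ m → ∀ c → Agree m b c → ¬ A c) →
  NowhereDense A
disjointSubcylinder⇒NowhereDense avoid a (n , int) =
  let (b , a≈b , m , b-avoids) = avoid a n
      (c , b≈c , Ac) = int b a≈b m
  in b-avoids c b≈c Ac

⊆⋃⇒FirstCategory : {S : Pred (Seq X) 0ℓ} (N : ℕ → Pred (Seq X) 0ℓ) →
  (∀ k → NowhereDense (N k)) → S ⊆ ⋃ ℕ N → FirstCategory S
⊆⋃⇒FirstCategory {S = S} N nd S⊆⋃N =
  (λ k → N k ∩ S) ,
  (λ k → NowhereDense-⊆ proj₁ (nd k)) ,
  λ a → mk⇔ (λ Sa → let (k , Nka) = S⊆⋃N Sa in k , Nka , Sa)
            (λ (_ , _ , Sa) → Sa)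

shift : ℕ → Seq X → Seq X
shift i a k = a (i + k)

Agree-mono : ∀ {m n} {a b : Seq X} → m ≤ n → Agree n a b → Agree m a b
Agree-mono m≤n a≈b j j<m = a≈b j (<-≤-trans j<m m≤n)

Agree-shift : ∀ i {n} {a b : Seq X} → Agree (i + n) a b → Agree n (shift i a) (shift i b)
Agree-shift i a≈b j j<n = a≈b (i + j) (+-monoʳ-< i j<n)

Extends-Agree : {a b : Seq X} (p : FinSeq X) → Agree (proj₁ p) a b → Extends a p → Extends b p
Extends-Agree (n , v) a≈b a⊒v j = trans (sym (a≈b (toℕ j) (toℕ<n j))) (a⊒v j)

_++ˢ_ : ∀ {n} → Vec X n → Seq X → Seq X
([] ++ˢ s) k = s k
((x ∷ v) ++ˢ s) zero = x
((x ∷ v) ++ˢ s) (suc k) = (v ++ˢ s) k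

++ˢ-extends : ∀ {n} (v : Vec X n) (s : Seq X) → Extends (v ++ˢ s) (n , v)
++ˢ-extends (x ∷ v) s Fin.zero = refl
++ˢ-extends (x ∷ v) s (Fin.suc j) = ++ˢ-extends v s j

splice : Seq X → ℕ → FinSeq X → Seq X
splice a zero (n , v) = v ++ˢ shift n a
splice a (suc i) p zero = a zero
splice a (suc i) p (suc k) = splice (shift 1 a) i p k

splice-agrees : (a : Seq X) (i : ℕ) (p : FinSeq X) → Agree i a (splice a i p)
splice-agrees a (suc i) p zero z<s = refl
splice-agrees a (suc i) p (suc j) (s<s j<i) = splice-agrees (shift 1 a) i p j j<i

splice-extends : (a : Seq X) (i : ℕ) (p : FinSeq X) → Extends (shift i (splice a i p)) p
splice-extends a zero (n , v) = ++ˢ-extends v (shift n a)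
splice-extends a (suc i) p = splice-extends (shift 1 a) i p

module _ (J : ℕ → Set) (f : (i : ℕ) → J i → FinSeq X) where

  Hit : Seq X → ℕ → Set
  Hit a i = Σ (J i) λ ji → Extends (shift i a) (f i ji)

  NoHitFrom : ℕ → Pred (Seq X) 0ℓ
  NoHitFrom n a = ∀ i → n ≤ i → ¬ Hit a i

  NoHitFrom-nowhereDense : Infinite J → ∀ n → NowhereDense (NoHitFrom n)
  NoHitFrom-nowhereDense infJ n = disjointSubcylinder⇒NowhereDense λ a m →
    let (i , n⊔m≤i , ji) = infJ (n ⊔ m)
        p = f i ji
        b = splice a i p
    in b ,
       Agree-mono (≤-trans (m≤n⊔m n m) n⊔m≤i) (splice-agrees a i p) ,
       i + proj₁ p ,
       λ c b≈c noHit →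
         noHit i (≤-trans (m≤m⊔n n m) n⊔m≤i)
           (ji , Extends-Agree p (Agree-shift i b≈c) (splice-extends a i p))

¬infinitelyOften⇒eventuallyNever : DoubleNegationElimination 0ℓ → {P : ℕ → Set} →
  ¬ (∀ n → ∃ λ i → n ≤ i × P i) → ∃ λ n → ∀ i → n ≤ i → ¬ P i
¬infinitelyOften⇒eventuallyNever dne ¬io =
  dne λ ¬eventually → ¬io λ n →
    dne λ ¬hitAfter-n → ¬eventually (n , λ i n≤i Pi → ¬hitAfter-n (i , n≤i , Pi))

theorem1 : ExcludedMiddle 0ℓ → (X : Set) → X → (S : Seq X → Set) → SecondCategory S →
    (J : ℕ → Set) → Infinite J → (f : (i : ℕ) → J i → FinSeq X) →
    ∃ λ (a : Seq X) → S a ×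
      ((n : ℕ) → ∃ λ i → n ≤ i × Σ (J i) λ ji → Extends (λ k → a (i + k)) (f i ji))
theorem1 em X _ S secondCategory J infJ f = dne λ noGoodPoint →
  secondCategory
    (⊆⋃⇒FirstCategory (NoHitFrom J f) (NoHitFrom-nowhereDense J f infJ)
      λ {a} Sa → ¬infinitelyOften⇒eventuallyNever dne λ io → noGoodPoint (a , Sa , io))
  where
  dne : DoubleNegationElimination 0ℓ
  dne = em⇒dne em
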